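{- Let $\Omega$ be a set of size $m$, and let $D_1,\dots,D_q$ be subsets of $\Omega$ with $|D_i|\le u$ for all $1\le i\le q$. Let $\mathcal{F}=\{X\subseteq\Omega: D_i\subseteq X \text{ for some } 1\le i\le q\}$. Let $0<\tilde p\le p\le 1$. Then $$\frac{\sum_{X\in\mathcal{F}}\tilde p^{|X|}(1-\tilde p)^{m-|X|}}{\sum_{X\in\mathcal{F}}p^{|X|}(1-p)^{m-|X|}}\ \ge\ \left(\frac{\tilde p}{p}\right)^u.$$
   Formalization: The parameters $\tilde p$ and $p$ take rational values. -}

module Defs where

open import Data.Nat using (ℕ; zero; suc)
open import Data.Bool using (Bool; true; false)
open import Data.Fin using (Fin)
open import Data.Fin.Subset using (Subset; _⊆_; ∣_∣)
open import Data.Fin.Subset.Properties using (_⊆?_)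
open import Data.Fin.Properties using (any?)
open import Data.Product using (∃)
open import Data.List using (List; []; _∷_; map; _++_; filter; foldr)
open import Data.Vec using (_∷_; [])
open import Data.Rational using (ℚ; 0ℚ; 1ℚ; _+_; _*_; _-_)
open import Relation.Nullary using (Dec)

infixr 8 _^_
_^_ : ℚ → ℕ → ℚ
x ^ zero  = 1ℚ
x ^ suc n = x * (x ^ n)

allSubsets : (m : ℕ) → List (Subset m)
allSubsets zero    = [] ∷ []
allSubsets (suc m) = map (false ∷_) (allSubsets m) ++ map (true ∷_) (allSubsets m)

sumℚ : List ℚ → ℚ
sumℚ = foldr _+_ 0ℚ

InF : ∀ {m q} → (Fin q → Subset m) → Subset m → Set
InF D X = ∃ λ i → D i ⊆ X

InF? : ∀ {m q} (D : Fin q → Subset m) (X : Subset m) → Dec (InF D X)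
InF? D X = any? (λ i → D i ⊆? X)

μ : ∀ {m q} → ℚ → (Fin q → Subset m) → ℚ
μ {m} p D = sumℚ (map (λ X → (p ^ ∣ X ∣) * ((1ℚ - p) ^ (m Data.Nat.∸ ∣ X ∣)))
                      (filter (InF? D) (allSubsets m)))

module Submission where

-- Write r = p̃/p. A p̃-random subset of Ω has the law of a p-random subset X thinned by keeping
-- each of its points independently with probability r. If D i ⊆ X, the thinned set still contains
-- D i with probability at least r^|D i| ≥ r^u, and it then lies in F because F is up-closed.

open import Defs
open import Data.Nat using (ℕ; zero; suc; z≤n; s≤s; _∸_)
import Data.Nat as ℕ
open import Data.Nat.Properties using (+-∸-assoc)
open import Data.Bool using (false; true)
open import Data.Fin using (Fin)
open import Data.Fin.Subset using (Subset; _⊆_; ∣_∣)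
open import Data.Fin.Subset.Properties using (drop-∷-⊆; out⊆; in⊆in; ∣p∣≤n)
open import Data.Vec using ([]; _∷_; here)
open import Data.List using ([]; _∷_; map; _++_; filter)
import Data.List.Properties as List
open import Data.Product using (_,_)
open import Data.Rational
  using (ℚ; 0ℚ; 1ℚ; _≤_; _<_; _÷_; NonZero; Positive; _*_; _+_; _-_; -_; 1/_; positive; nonNegative)
open import Data.Rational.Properties
  using (≤-refl; ≤-trans; ≤-reflexive; <⇒≤; <-≤-trans; +-mono-≤; +-monoˡ-≤;
         *-monoˡ-≤-nonNeg; *-monoʳ-≤-nonNeg; nonNegative⁻¹; pos⇒nonNeg; 1/pos⇒pos;
         +-identityˡ; +-identityʳ; +-assoc; +-inverseʳ; *-identityˡ; *-identityʳ; *-zeroʳ; *-assoc;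
         *-distribˡ-+; *-inverseˡ; *-inverseʳ; module ≤-Reasoning)
open import Data.Rational.Solver using (module +-*-Solver)
open import Function using (_∘_)
open import Relation.Nullary using (Dec; yes; no)
open import Relation.Nullary.Negation using (contradiction)
open import Relation.Binary.PropositionalEquality
  using (_≡_; refl; sym; trans; cong; cong₂; module ≡-Reasoning)

open +-*-Solver

variable
  p q r : ℚ

*-monoˡ-≤-0≤ : 0ℚ ≤ r → p ≤ q → r * p ≤ r * q
*-monoˡ-≤-0≤ {r} 0≤r = *-monoˡ-≤-nonNeg r {{nonNegative 0≤r}}

*-0≤ : 0ℚ ≤ p → 0ℚ ≤ q → 0ℚ ≤ p * q
*-0≤ {p} 0≤p 0≤q = ≤-trans (≤-reflexive (sym (*-zeroʳ p))) (*-monoˡ-≤-0≤ 0≤p 0≤q)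

p≤1⇒0≤1-p : p ≤ 1ℚ → 0ℚ ≤ 1ℚ - p
p≤1⇒0≤1-p {p} p≤1 = ≤-trans (≤-reflexive (sym (+-inverseʳ p))) (+-monoˡ-≤ (- p) p≤1)

convex-mono-≤ : ∀ {a b c d} → 0ℚ ≤ r → r ≤ 1ℚ → a ≤ b → c ≤ d →
                r * a + (1ℚ - r) * c ≤ r * b + (1ℚ - r) * d
convex-mono-≤ 0≤r r≤1 a≤b c≤d = +-mono-≤ (*-monoˡ-≤-0≤ 0≤r a≤b) (*-monoˡ-≤-0≤ (p≤1⇒0≤1-p r≤1) c≤d)

0≤1/q : .{{_ : NonZero q}} → 0ℚ < q → 0ℚ ≤ 1/ q
0≤1/q {q} 0<q = nonNegative⁻¹ (1/ q) {{pos⇒nonNeg (1/ q) {{1/q-pos}}}}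
  where
  1/q-pos : Positive (1/ q)
  1/q-pos = 1/pos⇒pos q {{positive 0<q}}

÷-0≤ : .{{_ : NonZero q}} → 0ℚ ≤ p → 0ℚ < q → 0ℚ ≤ p ÷ q
÷-0≤ 0≤p 0<q = *-0≤ 0≤p (0≤1/q 0<q)

÷-≤1 : .{{_ : NonZero q}} → p ≤ q → 0ℚ < q → p ÷ q ≤ 1ℚ
÷-≤1 {q} {p} p≤q 0<q = begin
  p * 1/ q  ≤⟨ *-monoʳ-≤-nonNeg (1/ q) {{nonNegative (0≤1/q 0<q)}} p≤q ⟩
  q * 1/ q  ≡⟨ *-inverseʳ q ⟩
  1ℚ        ∎
  where open ≤-Reasoning

÷-*-cancel : ∀ p q .{{_ : NonZero q}} → (p ÷ q) * q ≡ p
÷-*-cancel p q = trans (*-assoc p (1/ q) q) (trans (cong (p *_) (*-inverseˡ q)) (*-identityʳ p))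

^-≤1 : 0ℚ ≤ r → r ≤ 1ℚ → ∀ n → r ^ n ≤ 1ℚ
^-≤1 _ _ zero = ≤-refl
^-≤1 {r} 0≤r r≤1 (suc n) = begin
  r * r ^ n  ≤⟨ *-monoˡ-≤-0≤ 0≤r (^-≤1 0≤r r≤1 n) ⟩
  r * 1ℚ     ≡⟨ *-identityʳ r ⟩
  r          ≤⟨ r≤1 ⟩
  1ℚ         ∎
  where open ≤-Reasoning

^-antitone : 0ℚ ≤ r → r ≤ 1ℚ → ∀ {k n} → k ℕ.≤ n → r ^ n ≤ r ^ k
^-antitone 0≤r r≤1 {n = n} z≤n = ^-≤1 0≤r r≤1 n
^-antitone 0≤r r≤1 (s≤s k≤n)   = *-monoˡ-≤-0≤ 0≤r (^-antitone 0≤r r≤1 k≤n)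

indicator : {P : Set} → Dec P → ℚ
indicator (yes _) = 1ℚ
indicator (no _)  = 0ℚ

indicator-0≤ : {P : Set} (P? : Dec P) → 0ℚ ≤ indicator P?
indicator-0≤ (yes _) = nonNegative⁻¹ 1ℚ
indicator-0≤ (no _)  = ≤-refl

indicator-yes : {P : Set} (P? : Dec P) → P → indicator P? ≡ 1ℚ
indicator-yes (yes _) _ = refl
indicator-yes (no ¬p) p = contradiction p ¬p

sumℚ-++ : ∀ xs ys → sumℚ (xs ++ ys) ≡ sumℚ xs + sumℚ ys
sumℚ-++ []       ys = sym (+-identityˡ (sumℚ ys))
sumℚ-++ (x ∷ xs) ys = trans (cong (x +_) (sumℚ-++ xs ys)) (sym (+-assoc x (sumℚ xs) (sumℚ ys)))

sumℚ-map-* : ∀ {A : Set} c (f : A → ℚ) xs → sumℚ (map (λ x → c * f x) xs) ≡ c * sumℚ (map f xs)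
sumℚ-map-* c f []       = sym (*-zeroʳ c)
sumℚ-map-* c f (x ∷ xs) =
  trans (cong (c * f x +_) (sumℚ-map-* c f xs)) (sym (*-distribˡ-+ c (f x) (sumℚ (map f xs))))

sumℚ-filter : ∀ {A : Set} {P : A → Set} (P? : ∀ x → Dec (P x)) (w : A → ℚ) xs →
              sumℚ (map w (filter P? xs)) ≡ sumℚ (map (λ x → w x * indicator (P? x)) xs)
sumℚ-filter P? w [] = refl
sumℚ-filter P? w (x ∷ xs) with P? x
... | yes _ = cong₂ _+_ (sym (*-identityʳ (w x))) (sumℚ-filter P? w xs)
... | no _  = begin
  sumℚ (map w (filter P? xs))    ≡⟨ sumℚ-filter P? w xs ⟩
  S                              ≡⟨ sym (+-identityˡ S) ⟩
  0ℚ + S                         ≡⟨ cong (_+ S) (sym (*-zeroʳ (w x))) ⟩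
  w x * 0ℚ + S                   ∎
  where
  open ≡-Reasoning
  S = sumℚ (map (λ x → w x * indicator (P? x)) xs)

sumℚ-allSubsets-suc : ∀ {m} (F : Subset (suc m) → ℚ) →
  sumℚ (map F (allSubsets (suc m))) ≡
  sumℚ (map (F ∘ (false ∷_)) (allSubsets m)) + sumℚ (map (F ∘ (true ∷_)) (allSubsets m))
sumℚ-allSubsets-suc {m} F = begin
  sumℚ (map F (map (false ∷_) A ++ map (true ∷_) A))
    ≡⟨ cong sumℚ (List.map-++ F (map (false ∷_) A) (map (true ∷_) A)) ⟩
  sumℚ (map F (map (false ∷_) A) ++ map F (map (true ∷_) A))
    ≡⟨ sumℚ-++ (map F (map (false ∷_) A)) (map F (map (true ∷_) A)) ⟩
  sumℚ (map F (map (false ∷_) A)) + sumℚ (map F (map (true ∷_) A))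
    ≡⟨ sym (cong₂ _+_ (cong sumℚ (List.map-∘ A)) (cong sumℚ (List.map-∘ A))) ⟩
  sumℚ (map (F ∘ (false ∷_)) A) + sumℚ (map (F ∘ (true ∷_)) A)
    ∎
  where
  open ≡-Reasoning
  A = allSubsets m

expect : ℚ → ∀ {m} → (Subset m → ℚ) → ℚ
expect p {zero}  g = g []
expect p {suc m} g = (1ℚ - p) * expect p (g ∘ (false ∷_)) + p * expect p (g ∘ (true ∷_))

expect-+ : ∀ p {m} (f g : Subset m → ℚ) → expect p (λ X → f X + g X) ≡ expect p f + expect p g
expect-+ p {zero}  f g = refl
expect-+ p {suc m} f g =
  trans (cong₂ (λ a b → (1ℚ - p) * a + p * b) (expect-+ p f₀ g₀) (expect-+ p f₁ g₁))
        (solve 6 (λ q p a b c d → q :* (a :+ b) :+ p :* (c :+ d) := (q :* a :+ p :* c) :+ (q :* b :+ p :* d))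
               refl (1ℚ - p) p (expect p f₀) (expect p g₀) (expect p f₁) (expect p g₁))
  where
  f₀ f₁ g₀ g₁ : Subset m → ℚ
  f₀ = f ∘ (false ∷_)
  f₁ = f ∘ (true ∷_)
  g₀ = g ∘ (false ∷_)
  g₁ = g ∘ (true ∷_)

expect-* : ∀ p {m} c (f : Subset m → ℚ) → expect p (λ X → c * f X) ≡ c * expect p f
expect-* p {zero}  c f = refl
expect-* p {suc m} c f =
  trans (cong₂ (λ a b → (1ℚ - p) * a + p * b) (expect-* p c f₀) (expect-* p c f₁))
        (solve 5 (λ q p c a b → q :* (c :* a) :+ p :* (c :* b) := c :* (q :* a :+ p :* b))
               refl (1ℚ - p) p c (expect p f₀) (expect p f₁))
  where
  f₀ f₁ : Subset m → ℚ
  f₀ = f ∘ (false ∷_)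
  f₁ = f ∘ (true ∷_)

expect-mono-≤ : 0ℚ ≤ p → p ≤ 1ℚ → ∀ {m} {f g : Subset m → ℚ} →
                (∀ X → f X ≤ g X) → expect p f ≤ expect p g
expect-mono-≤ 0≤p p≤1 {zero}  f≤g = f≤g []
expect-mono-≤ 0≤p p≤1 {suc m} f≤g =
  +-mono-≤ (*-monoˡ-≤-0≤ (p≤1⇒0≤1-p p≤1) (expect-mono-≤ 0≤p p≤1 (f≤g ∘ (false ∷_))))
           (*-monoˡ-≤-0≤ 0≤p (expect-mono-≤ 0≤p p≤1 (f≤g ∘ (true ∷_))))

weight : ℚ → ∀ {m} → Subset m → ℚ
weight p {m} X = p ^ ∣ X ∣ * (1ℚ - p) ^ (m ∸ ∣ X ∣)

weight-false : ∀ p {m} (X : Subset m) → weight p (false ∷ X) ≡ (1ℚ - p) * weight p X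
weight-false p {m} X = begin
  p ^ ∣ X ∣ * (1ℚ - p) ^ (suc m ∸ ∣ X ∣)
    ≡⟨ cong (λ k → p ^ ∣ X ∣ * (1ℚ - p) ^ k) (+-∸-assoc 1 (∣p∣≤n X)) ⟩
  p ^ ∣ X ∣ * ((1ℚ - p) * (1ℚ - p) ^ (m ∸ ∣ X ∣))
    ≡⟨ solve 3 (λ a c b → a :* (c :* b) := c :* (a :* b)) refl (p ^ ∣ X ∣) (1ℚ - p) ((1ℚ - p) ^ (m ∸ ∣ X ∣)) ⟩
  (1ℚ - p) * weight p X
    ∎
  where open ≡-Reasoning

weight-true : ∀ p {m} (X : Subset m) → weight p (true ∷ X) ≡ p * weight p X
weight-true p {m} X = *-assoc p (p ^ ∣ X ∣) ((1ℚ - p) ^ (m ∸ ∣ X ∣))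

sumℚ-weight≡expect : ∀ p m (g : Subset m → ℚ) →
                     sumℚ (map (λ X → weight p X * g X) (allSubsets m)) ≡ expect p g
sumℚ-weight≡expect p zero    g = trans (+-identityʳ (1ℚ * g [])) (*-identityˡ (g []))
sumℚ-weight≡expect p (suc m) g = begin
  sumℚ (map (λ X → weight p X * g X) (allSubsets (suc m)))
    ≡⟨ sumℚ-allSubsets-suc (λ X → weight p X * g X) ⟩
  sumℚ (map (λ X → weight p (false ∷ X) * g₀ X) A) + sumℚ (map (λ X → weight p (true ∷ X) * g₁ X) A)
    ≡⟨ cong₂ _+_ (cong sumℚ (List.map-cong peel-false A)) (cong sumℚ (List.map-cong peel-true A)) ⟩
  sumℚ (map (λ X → (1ℚ - p) * (weight p X * g₀ X)) A) + sumℚ (map (λ X → p * (weight p X * g₁ X)) A)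
    ≡⟨ cong₂ _+_ (sumℚ-map-* (1ℚ - p) (λ X → weight p X * g₀ X) A) (sumℚ-map-* p (λ X → weight p X * g₁ X) A) ⟩
  (1ℚ - p) * sumℚ (map (λ X → weight p X * g₀ X) A) + p * sumℚ (map (λ X → weight p X * g₁ X) A)
    ≡⟨ cong₂ (λ a b → (1ℚ - p) * a + p * b) (sumℚ-weight≡expect p m g₀) (sumℚ-weight≡expect p m g₁) ⟩
  expect p g
    ∎
  where
  open ≡-Reasoning
  A = allSubsets m
  g₀ g₁ : Subset m → ℚ
  g₀ = g ∘ (false ∷_)
  g₁ = g ∘ (true ∷_)
  peel-false : ∀ X → weight p (false ∷ X) * g₀ X ≡ (1ℚ - p) * (weight p X * g₀ X)
  peel-false X = trans (cong (_* g₀ X) (weight-false p X)) (*-assoc (1ℚ - p) (weight p X) (g₀ X))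
  peel-true : ∀ X → weight p (true ∷ X) * g₁ X ≡ p * (weight p X * g₁ X)
  peel-true X = trans (cong (_* g₁ X) (weight-true p X)) (*-assoc p (weight p X) (g₁ X))

𝟙[_] : ∀ {m q} → (Fin q → Subset m) → Subset m → ℚ
𝟙[ D ] X = indicator (InF? D X)

μ≡expect-𝟙 : ∀ p {m q} (D : Fin q → Subset m) → μ p D ≡ expect p 𝟙[ D ]
μ≡expect-𝟙 p {m} D =
  trans (sumℚ-filter (InF? D) (weight p) (allSubsets m)) (sumℚ-weight≡expect p m 𝟙[ D ])

-- thin r f X is the expectation of f at a random subset of X keeping each point of X
-- independently with probability r.
thin : ℚ → ∀ {m} → (Subset m → ℚ) → Subset m → ℚ
thin r {zero}  f X           = f X
thin r {suc m} f (false ∷ X) = thin r (f ∘ (false ∷_)) X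
thin r {suc m} f (true ∷ X)  = r * thin r (f ∘ (true ∷_)) X + (1ℚ - r) * thin r (f ∘ (false ∷_)) X

expect-thin : ∀ p r {m} (f : Subset m → ℚ) → expect p (thin r f) ≡ expect (r * p) f
expect-thin p r {zero}  f = refl
expect-thin p r {suc m} f = begin
  (1ℚ - p) * expect p (thin r f₀) + p * expect p (λ X → r * thin r f₁ X + (1ℚ - r) * thin r f₀ X)
    ≡⟨ cong (λ e → (1ℚ - p) * expect p (thin r f₀) + p * e) split ⟩
  (1ℚ - p) * expect p (thin r f₀) + p * (r * expect p (thin r f₁) + (1ℚ - r) * expect p (thin r f₀))
    ≡⟨ cong₂ (λ a b → (1ℚ - p) * a + p * (r * b + (1ℚ - r) * a)) (expect-thin p r f₀) (expect-thin p r f₁) ⟩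
  (1ℚ - p) * expect (r * p) f₀ + p * (r * expect (r * p) f₁ + (1ℚ - r) * expect (r * p) f₀)
    ≡⟨ solve 4 (λ p r a b → (con 1ℚ :- p) :* a :+ p :* (r :* b :+ (con 1ℚ :- r) :* a)
                          := (con 1ℚ :- r :* p) :* a :+ r :* p :* b)
               refl p r (expect (r * p) f₀) (expect (r * p) f₁) ⟩
  expect (r * p) f
    ∎
  where
  open ≡-Reasoning
  f₀ f₁ : Subset m → ℚ
  f₀ = f ∘ (false ∷_)
  f₁ = f ∘ (true ∷_)
  split : expect p (λ X → r * thin r f₁ X + (1ℚ - r) * thin r f₀ X)
        ≡ r * expect p (thin r f₁) + (1ℚ - r) * expect p (thin r f₀)
  split = trans (expect-+ p (λ X → r * thin r f₁ X) (λ X → (1ℚ - r) * thin r f₀ X))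
                (cong₂ _+_ (expect-* p r (thin r f₁)) (expect-* p (1ℚ - r) (thin r f₀)))

thin-0≤ : 0ℚ ≤ r → r ≤ 1ℚ → ∀ {m} (f : Subset m → ℚ) → (∀ X → 0ℚ ≤ f X) → ∀ X → 0ℚ ≤ thin r f X
thin-0≤ 0≤r r≤1 {zero}  f f≥0 X           = f≥0 X
thin-0≤ 0≤r r≤1 {suc m} f f≥0 (false ∷ X) = thin-0≤ 0≤r r≤1 _ (f≥0 ∘ (false ∷_)) X
thin-0≤ 0≤r r≤1 {suc m} f f≥0 (true ∷ X)  =
  +-mono-≤ (*-0≤ 0≤r (thin-0≤ 0≤r r≤1 _ (f≥0 ∘ (true ∷_)) X))
           (*-0≤ (p≤1⇒0≤1-p r≤1) (thin-0≤ 0≤r r≤1 _ (f≥0 ∘ (false ∷_)) X))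

thin-≥-^ : 0ℚ ≤ r → r ≤ 1ℚ → ∀ {m} (f : Subset m → ℚ) → (∀ X → 0ℚ ≤ f X) →
           (A : Subset m) → (∀ Y → A ⊆ Y → 1ℚ ≤ f Y) → ∀ X → A ⊆ X → r ^ ∣ A ∣ ≤ thin r f X
thin-≥-^ 0≤r r≤1 {zero} f f≥0 [] f≥1 [] A⊆X = f≥1 [] A⊆X
thin-≥-^ 0≤r r≤1 {suc m} f f≥0 (false ∷ A) f≥1 (false ∷ X) A⊆X =
  thin-≥-^ 0≤r r≤1 _ (f≥0 ∘ (false ∷_)) A (λ Y → f≥1 (false ∷ Y) ∘ out⊆) X (drop-∷-⊆ A⊆X)
thin-≥-^ 0≤r r≤1 {suc m} f f≥0 (true ∷ A) f≥1 (false ∷ X) A⊆X with A⊆X here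
... | ()
thin-≥-^ {r} 0≤r r≤1 {suc m} f f≥0 (false ∷ A) f≥1 (true ∷ X) A⊆X = begin
  r ^ ∣ A ∣
    ≡⟨ solve 2 (λ r a → a := r :* a :+ (con 1ℚ :- r) :* a) refl r (r ^ ∣ A ∣) ⟩
  r * r ^ ∣ A ∣ + (1ℚ - r) * r ^ ∣ A ∣
    ≤⟨ convex-mono-≤ 0≤r r≤1
         (thin-≥-^ 0≤r r≤1 _ (f≥0 ∘ (true ∷_)) A (λ Y → f≥1 (true ∷ Y) ∘ out⊆) X (drop-∷-⊆ A⊆X))
         (thin-≥-^ 0≤r r≤1 _ (f≥0 ∘ (false ∷_)) A (λ Y → f≥1 (false ∷ Y) ∘ out⊆) X (drop-∷-⊆ A⊆X)) ⟩
  r * thin r (f ∘ (true ∷_)) X + (1ℚ - r) * thin r (f ∘ (false ∷_)) X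
    ∎
  where open ≤-Reasoning
thin-≥-^ {r} 0≤r r≤1 {suc m} f f≥0 (true ∷ A) f≥1 (true ∷ X) A⊆X = begin
  r * r ^ ∣ A ∣
    ≡⟨ solve 2 (λ r a → r :* a := r :* a :+ (con 1ℚ :- r) :* con 0ℚ) refl r (r ^ ∣ A ∣) ⟩
  r * r ^ ∣ A ∣ + (1ℚ - r) * 0ℚ
    ≤⟨ convex-mono-≤ 0≤r r≤1
         (thin-≥-^ 0≤r r≤1 _ (f≥0 ∘ (true ∷_)) A (λ Y → f≥1 (true ∷ Y) ∘ in⊆in) X (drop-∷-⊆ A⊆X))
         (thin-0≤ 0≤r r≤1 _ (f≥0 ∘ (false ∷_)) X) ⟩
  r * thin r (f ∘ (true ∷_)) X + (1ℚ - r) * thin r (f ∘ (false ∷_)) X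
    ∎
  where open ≤-Reasoning

^-*-𝟙≤thin-𝟙 : ∀ {m q u} (D : Fin q → Subset m) → (∀ i → ∣ D i ∣ ℕ.≤ u) → 0ℚ ≤ r → r ≤ 1ℚ →
               ∀ X → r ^ u * 𝟙[ D ] X ≤ thin r 𝟙[ D ] X
^-*-𝟙≤thin-𝟙 {r = r} {u = u} D ∣D∣≤u 0≤r r≤1 X with InF? D X
... | yes (i , Dᵢ⊆X) = begin
  r ^ u * 1ℚ       ≡⟨ *-identityʳ (r ^ u) ⟩
  r ^ u            ≤⟨ ^-antitone 0≤r r≤1 (∣D∣≤u i) ⟩
  r ^ ∣ D i ∣      ≤⟨ thin-≥-^ 0≤r r≤1 𝟙[ D ] 𝟙-0≤ (D i) 𝟙≥1 X Dᵢ⊆X ⟩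
  thin r 𝟙[ D ] X  ∎
  where
  open ≤-Reasoning
  𝟙-0≤ : ∀ Y → 0ℚ ≤ 𝟙[ D ] Y
  𝟙-0≤ Y = indicator-0≤ (InF? D Y)
  𝟙≥1 : ∀ Y → D i ⊆ Y → 1ℚ ≤ 𝟙[ D ] Y
  𝟙≥1 Y Dᵢ⊆Y = ≤-reflexive (sym (indicator-yes (InF? D Y) (i , Dᵢ⊆Y)))
... | no _ = begin
  r ^ u * 0ℚ       ≡⟨ *-zeroʳ (r ^ u) ⟩
  0ℚ               ≤⟨ thin-0≤ 0≤r r≤1 𝟙[ D ] (indicator-0≤ ∘ InF? D) X ⟩
  thin r 𝟙[ D ] X  ∎
  where open ≤-Reasoning

lemma3p5 : (m q u : ℕ) (D : Fin q → Subset m) → (∀ i → ∣ D i ∣ Data.Nat.≤ u) →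
           (p̃ p : ℚ) → 0ℚ < p̃ → p̃ ≤ p → p ≤ 1ℚ → .{{_ : NonZero p}} →
           ((p̃ ÷ p) ^ u) * μ p D ≤ μ p̃ D
lemma3p5 m q u D ∣D∣≤u p̃ p 0<p̃ p̃≤p p≤1 = begin
  (p̃ ÷ p) ^ u * μ p D                       ≡⟨ cong ((p̃ ÷ p) ^ u *_) (μ≡expect-𝟙 p D) ⟩
  (p̃ ÷ p) ^ u * expect p 𝟙[ D ]             ≡⟨ sym (expect-* p ((p̃ ÷ p) ^ u) 𝟙[ D ]) ⟩
  expect p (λ X → (p̃ ÷ p) ^ u * 𝟙[ D ] X)   ≤⟨ expect-mono-≤ (<⇒≤ 0<p) p≤1 (^-*-𝟙≤thin-𝟙 D ∣D∣≤u 0≤r r≤1) ⟩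
  expect p (thin (p̃ ÷ p) 𝟙[ D ])            ≡⟨ expect-thin p (p̃ ÷ p) 𝟙[ D ] ⟩
  expect ((p̃ ÷ p) * p) 𝟙[ D ]               ≡⟨ cong (λ s → expect s 𝟙[ D ]) (÷-*-cancel p̃ p) ⟩
  expect p̃ 𝟙[ D ]                           ≡⟨ sym (μ≡expect-𝟙 p̃ D) ⟩
  μ p̃ D                                     ∎
  where
  open ≤-Reasoning
  0<p : 0ℚ < p
  0<p = <-≤-trans 0<p̃ p̃≤p
  0≤r : 0ℚ ≤ p̃ ÷ p
  0≤r = ÷-0≤ (<⇒≤ 0<p̃) 0<p
  r≤1 : p̃ ÷ p ≤ 1ℚ
  r≤1 = ÷-≤1 p̃≤p 0<p
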